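{- Assume the Weighted Budgeted Matching instance $(G,p,(V_g),(\rho_g))$ admits a feasible solution (a matching of $G$ matching at least $\rho_g$ vertices of $V_g$ for every $g$). Let $\mathcal{M}_H$ be a maximum-weight matching in the graph $H$ constructed in the context. Then for every $g\in\{1,\dots,\omega\}$, at least $\rho_g$ vertices of $V_g$ are matched in $\mathcal{M}_H$ by edges belonging to $E$ (the edge set of $G$).
   Context: Weighted Budgeted Matching instance: a graph $G=(V,E)$ with $n=|V|$, edge weights $p:E\to\mathbb{R}_{\ge 0}$, a partition $V=V_1\cup\dots\cup V_\omega$, and integers $0\le\rho_g\le|V_g|$; the goal is a minimum-weight matching of $G$ in which at least $\rho_g$ vertices of each $V_g$ are matched. Construction: fix a number $M>\sum_{e\in E}p_e$. Let $H$ be the graph obtained from $G$ by adding, for each $g$, a set $V'_g$ of $|V_g|-\rho_g$ new vertices and all edges between $V'_g$ and $V_g$. Edge weights in $H$: an edge $e\in E$ has weight $2M-p_e$, and each added edge $(x,y)$ with $x\in V'_g$, $y\in V_g$ has weight $M$.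
   Formalization: The edge weights $p$ are nonnegative rationals instead of nonnegative reals, and the number $M$ is rational. -}

module Defs where

open import Data.Nat as ℕ using (ℕ; _∸_)
open import Data.Fin as Fin using (Fin)
open import Data.Fin.Properties using () renaming (_≟_ to _≟ᶠ_)
open import Data.List using (List; []; _∷_; length; filter; allFin)
open import Data.List.Relation.Unary.All using (All)
open import Data.List.Relation.Unary.Any using (Any)
open import Data.List.Relation.Unary.AllPairs using (AllPairs)
open import Data.List.Relation.Unary.Unique.Propositional using (Unique)
open import Data.Product using (Σ; _×_; _,_; proj₁; proj₂; ∃)
open import Data.Sum using (_⊎_; inj₁; inj₂)
open import Data.Rational using (ℚ; 0ℚ; _+_; _-_; _≤_; _<_)
open import Relation.Binary.PropositionalEquality using (_≡_)
open import Relation.Nullary using (¬_)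
open import Data.Unit using (⊤)

-- Generic (undirected) graphs with weighted edges and matchings.
-- An edge e has two endpoints  ends e = (u , v)  (order irrelevant).

record Graph : Set₁ where
  field
    Vtx  : Set
    Edge : Set
    ends : Edge → Vtx × Vtx
open Graph public

Incident : (G : Graph) → Vtx G → Edge G → Set
Incident G v e = v ≡ proj₁ (ends G e) ⊎ v ≡ proj₂ (ends G e)

Disjointₑ : (G : Graph) → Edge G → Edge G → Set
Disjointₑ G e f = ∀ v → Incident G v e → ¬ (Incident G v f)

-- a matching is a (finite) list of pairwise vertex-disjoint edges
-- (pairwise disjointness also forces the listed edges to be distinct)
IsMatching : (G : Graph) → List (Edge G) → Set
IsMatching G = AllPairs (Disjointₑ G)

weight : {E : Set} → (E → ℚ) → List E → ℚ
weight w []       = 0ℚ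
weight w (e ∷ es) = w e + weight w es

-- "at least k vertices satisfying P are matched by edges of the list
--  satisfying Q": there are k distinct such vertices, each an endpoint
--  of some edge of the list satisfying Q.
AtLeastCovered : (G : Graph) → ℕ → (Vtx G → Set) → (Edge G → Set)
               → List (Edge G) → Set
AtLeastCovered G k P Q Mt =
  Σ (List (Vtx G)) λ S → Unique S × k ℕ.≤ length S
    × All (λ v → P v × Any (λ e → Q e × Incident G v e) Mt) S

sumFin : (m : ℕ) → (Fin m → ℚ) → ℚ
sumFin ℕ.zero    f = 0ℚ
sumFin (ℕ.suc m) f = f Fin.zero + sumFin m (λ i → f (Fin.suc i))

-- Partition V = V_1 ∪ … ∪ V_ω given by a colouring  grp : Fin n → Fin ω
-- (V_g = { v | grp v ≡ g }).

record WBM : Set where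
  field
    n m ω   : ℕ
    edgeEnds : Fin m → Fin n × Fin n
    noLoop  : ∀ e → ¬ (proj₁ (edgeEnds e) ≡ proj₂ (edgeEnds e))
    simple  : ∀ e f → (edgeEnds e ≡ edgeEnds f ⊎ edgeEnds e ≡ (proj₂ (edgeEnds f) , proj₁ (edgeEnds f)))
                    → e ≡ f
    p       : Fin m → ℚ
    p≥0     : ∀ e → 0ℚ ≤ p e
    grp     : Fin n → Fin ω
    ρ       : Fin ω → ℕ

  size : Fin ω → ℕ
  size g = length (filter (λ v → grp v ≟ᶠ g) (allFin n))

  field
    ρ≤size : ∀ g → ρ g ℕ.≤ size g

  G : Graph
  G = record { Vtx = Fin n ; Edge = Fin m ; ends = edgeEnds }

  Feasible : Set
  Feasible = Σ (List (Fin m)) λ N → IsMatching G N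
           × (∀ g → AtLeastCovered G (ρ g) (λ v → grp v ≡ g) (λ _ → ⊤) N)

  totalP : ℚ
  totalP = sumFin m p

  -- The graph H: vertices Fin n ⊎ (new vertices V'_g, |V'_g| = |V_g| - ρ_g);
  -- edges: the original edges E, plus (x , y) for x ∈ V'_g, y ∈ V_g.

  NewVtx : Set
  NewVtx = Σ (Fin ω) λ g → Fin (size g ∸ ρ g)

  NewEdge : Set
  NewEdge = Σ (Fin ω) λ g → Fin (size g ∸ ρ g) × Σ (Fin n) (λ y → grp y ≡ g)

  VH : Set
  VH = Fin n ⊎ NewVtx

  EH : Set
  EH = Fin m ⊎ NewEdge

  endsH : EH → VH × VH
  endsH (inj₁ e) = inj₁ (proj₁ (edgeEnds e)) , inj₁ (proj₂ (edgeEnds e))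
  endsH (inj₂ (g , x , y , _)) = inj₂ (g , x) , inj₁ y

  H : Graph
  H = record { Vtx = VH ; Edge = EH ; ends = endsH }

  wH : ℚ → EH → ℚ
  wH M (inj₁ e) = (M + M) - p e
  wH M (inj₂ _) = M

  InE : EH → Set
  InE e = Σ (Fin m) λ e' → e ≡ inj₁ e'

{-# OPTIONS --safe #-}
-- An edge of E weighs M for each of its two endpoints minus p_e, and an added edge weighs M
-- for its single endpoint in G; so a matching of H weighs M·(number of vertices of G it covers)
-- minus the (non-negative) p-weight of its E-part.  A feasible matching N of G extends greedily
-- to a matching of H covering all of V(G): an uncovered vertex of V_g is matched to a free vertex
-- of V'_g, and one exists since at least ρ_g vertices of V_g are already covered by N.  That
-- matching has E-part p(N) ≤ Σ p < M, so it beats every matching missing a vertex of G; hence a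
-- maximum-weight matching covers V(G).  It matches at most |V'_g| = |V_g| − ρ_g vertices of V_g
-- through added edges, so at least ρ_g of them through edges of E.
module Submission where

open import Defs
open import Algebra.Bundles using (CommutativeMonoid)
open import Data.Empty using (⊥; ⊥-elim)
open import Data.Fin as Fin using (Fin)
open import Data.Fin.Properties using () renaming (_≟_ to _≟ᶠ_)
open import Data.List using (List; []; _∷_; _++_; length; filter; allFin; map; concatMap; tabulate)
open import Data.List.Properties using (length-++; length-map; length-tabulate; length-removeAt′)
open import Data.List.Membership.Propositional using (_∈_; _∉_; _─_; find; lose)
open import Data.List.Membership.Propositional.Properties
  using (∈-allFin; ∈-map⁺; ∈-map⁻; ∈-filter⁺; ∈-filter⁻; ∈-++⁺ˡ; ∈-++⁺ʳ; ∈-++⁻; ∈-concatMap⁺; ∈-concatMap⁻)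
import Data.List.Membership.DecPropositional as DecMembership
open import Data.List.Relation.Binary.Subset.Propositional using (_⊆_)
open import Data.List.Relation.Binary.Subset.Propositional.Properties using (Any-resp-⊆)
open import Data.List.Relation.Unary.All as All using (All; []; _∷_)
import Data.List.Relation.Unary.All.Properties as All
open import Data.List.Relation.Unary.Any as Any using (Any; here; there; any?)
import Data.List.Relation.Unary.Any.Properties as Any
open import Data.List.Relation.Unary.AllPairs as AllPairs using ([]; _∷_)
import Data.List.Relation.Unary.AllPairs.Properties as AllPairs
open import Data.List.Relation.Unary.Unique.Propositional using (Unique)
import Data.List.Relation.Unary.Unique.Propositional.Properties as Unique
open import Data.Nat as ℕ using (suc; z≤n; s≤s; _∸_)
import Data.Nat.Properties as ℕ
open import Data.Product using (Σ; ∃; _×_; _,_; proj₁; proj₂)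
import Data.Product.Properties as Σ
open import Data.Rational using (ℚ; 0ℚ; _+_; _≤_; _<_)
import Data.Rational.Properties as ℚ
open import Data.Rational.Solver using (module +-*-Solver)
open import Data.Sum as Sum using (_⊎_; inj₁; inj₂)
import Data.Sum.Properties as Sum
open import Data.Unit using (⊤)
open import Function using (_∘_; id)
open import Relation.Binary.Definitions using (DecidableEquality)
open import Relation.Binary.PropositionalEquality
  using (_≡_; _≢_; refl; sym; trans; cong; cong₂; subst; subst₂; ≢-sym; module ≡-Reasoning)
open import Relation.Nullary using (¬_; Dec; yes; no; _×-dec_; _⊎-dec_)

open import Algebra.Properties.CommutativeSemigroup
  (CommutativeMonoid.commutativeSemigroup ℚ.+-0-commutativeMonoid)
  using (interchange; x∙yz≈y∙xz)

module _ {A : Set} where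

  ∈-─ : ∀ {x y : A} {ys} (x∈ys : x ∈ ys) → y ∈ ys → y ≢ x → y ∈ ys ─ x∈ys
  ∈-─ (here refl)  (here refl)  y≢x = ⊥-elim (y≢x refl)
  ∈-─ (here refl)  (there y∈ys) _   = y∈ys
  ∈-─ (there _)    (here refl)  _   = here refl
  ∈-─ (there x∈ys) (there y∈ys) y≢x = there (∈-─ x∈ys y∈ys y≢x)

  ⊆-─ : ∀ {x : A} {xs ys} → All (x ≢_) xs → (x∈ys : x ∈ ys) → xs ⊆ ys → xs ⊆ ys ─ x∈ys
  ⊆-─ x∉xs x∈ys xs⊆ys y∈xs = ∈-─ x∈ys (xs⊆ys y∈xs) (≢-sym (All.lookup x∉xs y∈xs))

  unique∧⊆⇒length≤ : ∀ {xs ys : List A} → Unique xs → xs ⊆ ys → length xs ℕ.≤ length ys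
  unique∧⊆⇒length≤ {[]}          _            _     = z≤n
  unique∧⊆⇒length≤ {x ∷ xs} {ys} (x∉xs ∷ !xs) xs⊆ys = begin
      suc (length xs)          ≤⟨ s≤s (unique∧⊆⇒length≤ !xs (⊆-─ x∉xs x∈ys (λ y∈xs → xs⊆ys (there y∈xs)))) ⟩
      suc (length (ys ─ x∈ys)) ≡⟨ length-removeAt′ ys _ ⟨
      length ys                ∎
    where
      open ℕ.≤-Reasoning
      x∈ys = xs⊆ys (here refl)

  unique∧shorter⇒∃∉ : DecidableEquality A → ∀ {xs ys : List A} →
                      Unique xs → length ys ℕ.< length xs → Any (_∉ ys) xs
  unique∧shorter⇒∃∉ _≟_ {xs} {ys} !xs ys<xs =
    All.¬All⇒Any¬ (_∈? ys) xs λ xs⊆ys → ℕ.<⇒≱ ys<xs (unique∧⊆⇒length≤ !xs (All.lookup xs⊆ys))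
    where open DecMembership _≟_ using (_∈?_)

  weight-++ : (f : A → ℚ) (xs ys : List A) → weight f (xs ++ ys) ≡ weight f xs + weight f ys
  weight-++ f []       ys = sym (ℚ.+-identityˡ (weight f ys))
  weight-++ f (x ∷ xs) ys = begin
    f x + weight f (xs ++ ys)         ≡⟨ cong (f x +_) (weight-++ f xs ys) ⟩
    f x + (weight f xs + weight f ys) ≡⟨ ℚ.+-assoc (f x) _ _ ⟨
    (f x + weight f xs) + weight f ys ∎
    where open ≡-Reasoning

  weight-─ : (f : A → ℚ) {x : A} {ys : List A} (x∈ys : x ∈ ys) →
             weight f ys ≡ f x + weight f (ys ─ x∈ys)
  weight-─ f (here refl)                = refl
  weight-─ f {x} {y ∷ ys} (there x∈ys) = begin
    f y + weight f ys                  ≡⟨ cong (f y +_) (weight-─ f x∈ys) ⟩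
    f y + (f x + weight f (ys ─ x∈ys)) ≡⟨ x∙yz≈y∙xz (f y) (f x) _ ⟩
    f x + (f y + weight f (ys ─ x∈ys)) ∎
    where open ≡-Reasoning

  weight-nonneg : (f : A → ℚ) → (∀ x → 0ℚ ≤ f x) → ∀ xs → 0ℚ ≤ weight f xs
  weight-nonneg f f≥0 []       = ℚ.≤-refl
  weight-nonneg f f≥0 (x ∷ xs) = ℚ.+-mono-≤ (f≥0 x) (weight-nonneg f f≥0 xs)

  unique∧⊆⇒weight≤ : (f : A → ℚ) → (∀ x → 0ℚ ≤ f x) →
                     ∀ {xs ys} → Unique xs → xs ⊆ ys → weight f xs ≤ weight f ys
  unique∧⊆⇒weight≤ f f≥0 {[]}     {ys} _            _     = weight-nonneg f f≥0 ys
  unique∧⊆⇒weight≤ f f≥0 {x ∷ xs} {ys} (x∉xs ∷ !xs) xs⊆ys = begin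
      f x + weight f xs          ≤⟨ ℚ.+-monoʳ-≤ (f x) (unique∧⊆⇒weight≤ f f≥0 !xs xs⊆ys─x) ⟩
      f x + weight f (ys ─ x∈ys) ≡⟨ weight-─ f x∈ys ⟨
      weight f ys                ∎
    where
      open ℚ.≤-Reasoning
      x∈ys = xs⊆ys (here refl)
      xs⊆ys─x = ⊆-─ x∉xs x∈ys (λ y∈xs → xs⊆ys (there y∈xs))

weight-map : ∀ {A B : Set} (f : B → ℚ) (h : A → B) xs → weight f (map h xs) ≡ weight (λ x → f (h x)) xs
weight-map f h []       = refl
weight-map f h (x ∷ xs) = cong (f (h x) +_) (weight-map f h xs)

weight-tabulate : ∀ {A : Set} k (f : A → ℚ) (h : Fin k → A) →
                  weight f (tabulate h) ≡ sumFin k (λ i → f (h i))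
weight-tabulate ℕ.zero  f h = refl
weight-tabulate (suc k) f h = cong (f (h Fin.zero) +_) (weight-tabulate k f (λ i → h (Fin.suc i)))

≤+∸⇒≤ : ∀ {r s t} → r ℕ.≤ s → s ℕ.≤ t ℕ.+ (s ∸ r) → r ℕ.≤ t
≤+∸⇒≤ {r} {s} {t} r≤s s≤t+[s∸r] =
  ℕ.+-cancelʳ-≤ (s ∸ r) r t (subst (ℕ._≤ t ℕ.+ (s ∸ r)) (sym (ℕ.m+[n∸m]≡n r≤s)) s≤t+[s∸r])

+<⇒<∸ : ∀ {r s t a} → r ℕ.≤ t → t ℕ.+ a ℕ.< s → a ℕ.< s ∸ r
+<⇒<∸ {r} {s} {t} {a} r≤t t+a<s = ℕ.m+n≤o⇒m≤o∸n (suc a) (begin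
  suc a ℕ.+ r ≤⟨ ℕ.+-monoʳ-≤ (suc a) r≤t ⟩
  suc a ℕ.+ t ≡⟨ cong suc (ℕ.+-comm a t) ⟩
  suc (t ℕ.+ a) ≤⟨ t+a<s ⟩
  s ∎)
  where open ℕ.≤-Reasoning

module _ (G : Graph) where

  Incident? : DecidableEquality (Vtx G) → ∀ v e → Dec (Incident G v e)
  Incident? _≟_ v e = (v ≟ proj₁ (ends G e)) ⊎-dec (v ≟ proj₂ (ends G e))

  IsMatching⇒Unique : ∀ {L} → IsMatching G L → Unique L
  IsMatching⇒Unique = AllPairs.map λ { {e} e#f refl → e#f (proj₁ (ends G e)) (inj₁ refl) (inj₁ refl) }

  IsMatching⇒map-unique : (s : Edge G → Vtx G) → (∀ e → Incident G (s e) e) →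
                          ∀ {L} → IsMatching G L → Unique (map s L)
  IsMatching⇒map-unique s s-incident = AllPairs.map⁺ ∘ AllPairs.map λ {e} {f} e#f se≡sf →
    e#f (s e) (s-incident e) (subst (λ v → Incident G v f) (sym se≡sf) (s-incident f))

  IsMatching⇒concatMap-unique : ∀ {B : Set} (emb : B → Vtx G) (f : Edge G → List B) →
    (∀ e → Unique (f e)) → (∀ {a e} → a ∈ f e → Incident G (emb a) e) →
    ∀ {L} → IsMatching G L → Unique (concatMap f L)
  IsMatching⇒concatMap-unique emb f f-unique f-incident {L} L-matching =
    Unique.concat⁺ (All.map⁺ (All.universal f-unique L))
      (AllPairs.map⁺ (AllPairs.map (λ e#e′ {a} (a∈e , a∈e′) → e#e′ (emb a) (f-incident a∈e) (f-incident a∈e′))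
                                   L-matching))

  IsMatching⇒incident-unique : ∀ {L v e f} → IsMatching G L → e ∈ L → f ∈ L →
                               Incident G v e → Incident G v f → e ≡ f
  IsMatching⇒incident-unique (_    ∷ _) (here refl) (here refl) _ _ = refl
  IsMatching⇒incident-unique {v = v} (e#L ∷ _) (here refl) (there f∈L) v∈e v∈f =
    ⊥-elim (All.lookup e#L f∈L v v∈e v∈f)
  IsMatching⇒incident-unique {v = v} (f#L ∷ _) (there e∈L) (here refl) v∈e v∈f =
    ⊥-elim (All.lookup f#L e∈L v v∈f v∈e)
  IsMatching⇒incident-unique (_ ∷ L-matching) (there e∈L) (there f∈L) v∈e v∈f =
    IsMatching⇒incident-unique L-matching e∈L f∈L v∈e v∈f

-- The graph H

module _ (I : WBM) where
  open WBM I

  _≟ᴴ_ : DecidableEquality VH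
  _≟ᴴ_ = Sum.≡-dec _≟ᶠ_ (Σ.≡-dec _≟ᶠ_ _≟ᶠ_)

  Covers : List EH → VH → Set
  Covers L v = Any (Incident H v) L

  covers? : ∀ L v → Dec (Covers L v)
  covers? L v = any? (Incident? H _≟ᴴ_ v) L

  incident-E⁺ : ∀ {u e} → Incident G u e → Incident H (inj₁ u) (inj₁ e)
  incident-E⁺ = Sum.map (cong inj₁) (cong inj₁)

  incident-E⁻ : ∀ {u e} → Incident H (inj₁ u) (inj₁ e) → Incident G u e
  incident-E⁻ = Sum.map Sum.inj₁-injective Sum.inj₁-injective

  disjoint-E⁺ : ∀ {e f} → Disjointₑ G e f → Disjointₑ H (inj₁ e) (inj₁ f)
  disjoint-E⁺ e#f (inj₁ u) u∈e u∈f = e#f u (incident-E⁻ u∈e) (incident-E⁻ u∈f)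
  disjoint-E⁺ e#f (inj₂ _) (inj₁ ()) _
  disjoint-E⁺ e#f (inj₂ _) (inj₂ ()) _

  oldEnds : EH → List (Fin n)
  oldEnds (inj₁ e)               = proj₁ (edgeEnds e) ∷ proj₂ (edgeEnds e) ∷ []
  oldEnds (inj₂ (_ , _ , y , _)) = y ∷ []

  oldEnds-unique : ∀ e → Unique (oldEnds e)
  oldEnds-unique (inj₁ e) = (noLoop e ∷ []) ∷ [] ∷ []
  oldEnds-unique (inj₂ _) = [] ∷ []

  ∈-oldEnds⁺ : ∀ {a} e → Incident H (inj₁ a) e → a ∈ oldEnds e
  ∈-oldEnds⁺ (inj₁ e) (inj₁ refl) = here refl
  ∈-oldEnds⁺ (inj₁ e) (inj₂ refl) = there (here refl)
  ∈-oldEnds⁺ (inj₂ _) (inj₁ ())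
  ∈-oldEnds⁺ (inj₂ _) (inj₂ refl) = here refl

  ∈-oldEnds⁻ : ∀ {a e} → a ∈ oldEnds e → Incident H (inj₁ a) e
  ∈-oldEnds⁻ {e = inj₁ e} (here refl)         = inj₁ refl
  ∈-oldEnds⁻ {e = inj₁ e} (there (here refl)) = inj₂ refl
  ∈-oldEnds⁻ {e = inj₂ _} (here refl)         = inj₂ refl

  coveredOld : List EH → List (Fin n)
  coveredOld = concatMap oldEnds

  coveredOld-unique : ∀ {L} → IsMatching H L → Unique (coveredOld L)
  coveredOld-unique = IsMatching⇒concatMap-unique H inj₁ oldEnds oldEnds-unique ∈-oldEnds⁻

  Covers⇒∈coveredOld : ∀ {L a} → Covers L (inj₁ a) → a ∈ coveredOld L
  Covers⇒∈coveredOld = ∈-concatMap⁺ oldEnds ∘ Any.map (∈-oldEnds⁺ _)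

  ∈coveredOld⇒Covers : ∀ {L a} → a ∈ coveredOld L → Covers L (inj₁ a)
  ∈coveredOld⇒Covers = Any.map ∈-oldEnds⁻ ∘ ∈-concatMap⁻ oldEnds

  pᴴ : EH → ℚ
  pᴴ (inj₁ e) = p e
  pᴴ (inj₂ _) = 0ℚ

  pᴴ≥0 : ∀ e → 0ℚ ≤ pᴴ e
  pᴴ≥0 (inj₁ e) = p≥0 e
  pᴴ≥0 (inj₂ _) = ℚ.≤-refl

  wH+pᴴ≡ : ∀ M e → wH M e + pᴴ e ≡ weight (λ _ → M) (oldEnds e)
  wH+pᴴ≡ M (inj₁ e) = solve 2 (λ M q → ((M :+ M) :- q) :+ q := M :+ (M :+ con 0ℚ)) refl M (p e)
    where open +-*-Solver
  wH+pᴴ≡ M (inj₂ _) = refl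

  weight-wH : ∀ M L → weight (wH M) L + weight pᴴ L ≡ weight (λ _ → M) (coveredOld L)
  weight-wH M []      = ℚ.+-identityˡ 0ℚ
  weight-wH M (e ∷ L) = begin
    (wH M e + weight (wH M) L) + (pᴴ e + weight pᴴ L) ≡⟨ interchange (wH M e) _ (pᴴ e) _ ⟩
    (wH M e + pᴴ e) + (weight (wH M) L + weight pᴴ L) ≡⟨ cong₂ _+_ (wH+pᴴ≡ M e) (weight-wH M L) ⟩
    weight c (oldEnds e) + weight c (coveredOld L)    ≡⟨ weight-++ c (oldEnds e) (coveredOld L) ⟨
    weight c (coveredOld (e ∷ L))                     ∎
    where
      open ≡-Reasoning
      c = λ (_ : Fin n) → M

  AddedAt : Fin ω → EH → Set
  AddedAt g (inj₁ _)       = ⊥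
  AddedAt g (inj₂ (h , _)) = h ≡ g

  addedAt? : ∀ g e → Dec (AddedAt g e)
  addedAt? g (inj₁ _)       = no λ ()
  addedAt? g (inj₂ (h , _)) = h ≟ᶠ g

  inE? : ∀ e → Dec (InE e)
  inE? (inj₁ e) = yes (e , refl)
  inE? (inj₂ _) = no λ ()

  addedAt : Fin ω → List EH → List EH
  addedAt g = filter (addedAt? g)

  end₁ end₂ : EH → VH
  end₁ e = proj₁ (endsH e)
  end₂ e = proj₂ (endsH e)

  addedAt-ends-unique : ∀ g {L} → IsMatching H L →
                        Unique (map end₁ (addedAt g L)) × Unique (map end₂ (addedAt g L))
  addedAt-ends-unique g L-matching =
    IsMatching⇒map-unique H end₁ (λ _ → inj₁ refl) A-matching ,
    IsMatching⇒map-unique H end₂ (λ _ → inj₂ refl) A-matching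
    where A-matching = AllPairs.filter⁺ (addedAt? g) L-matching

  InGroup : Fin ω → VH → Set
  InGroup g v = Σ (Fin n) (λ y → v ≡ inj₁ y × grp y ≡ g)

  oldVertices newVertices : Fin ω → List VH
  oldVertices g = map inj₁ (filter (λ y → grp y ≟ᶠ g) (allFin n))
  newVertices g = map (λ x → inj₂ (g , x)) (allFin (size g ∸ ρ g))

  oldVertices-unique : ∀ g → Unique (oldVertices g)
  oldVertices-unique g = Unique.map⁺ Sum.inj₁-injective (Unique.filter⁺ (λ y → grp y ≟ᶠ g) (Unique.allFin⁺ n))

  newVertices-unique : ∀ g → Unique (newVertices g)
  newVertices-unique g = Unique.map⁺ (λ { refl → refl }) (Unique.allFin⁺ (size g ∸ ρ g))

  length-oldVertices : ∀ g → length (oldVertices g) ≡ size g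
  length-oldVertices g = length-map inj₁ (filter (λ y → grp y ≟ᶠ g) (allFin n))

  length-newVertices : ∀ g → length (newVertices g) ≡ size g ∸ ρ g
  length-newVertices g = trans (length-map _ (allFin (size g ∸ ρ g))) (length-tabulate id)

  ∈-oldVertices⁺ : ∀ {y g} → grp y ≡ g → inj₁ y ∈ oldVertices g
  ∈-oldVertices⁺ {y} gy≡g = ∈-map⁺ inj₁ (∈-filter⁺ (λ y → grp y ≟ᶠ _) (∈-allFin y) gy≡g)

  ∈-oldVertices⁻ : ∀ {v g} → v ∈ oldVertices g → InGroup g v
  ∈-oldVertices⁻ {g = g} v∈ with y , y∈ , refl ← ∈-map⁻ inj₁ v∈ =
    y , refl , proj₂ (∈-filter⁻ (λ y → grp y ≟ᶠ g) {xs = allFin n} y∈)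

  incident-new : ∀ {g x} e → Incident H (inj₂ (g , x)) e → AddedAt g e × end₁ e ≡ inj₂ (g , x)
  incident-new (inj₂ _) (inj₁ refl) = refl , refl
  incident-new (inj₁ _) (inj₂ ())
  incident-new (inj₂ _) (inj₂ ())

  incident-old : ∀ {y} e → Incident H (inj₁ y) e → InE e ⊎ (AddedAt (grp y) e × end₂ e ≡ inj₁ y)
  incident-old (inj₁ e)                (inj₁ _)    = inj₁ (e , refl)
  incident-old (inj₁ e)                (inj₂ _)    = inj₁ (e , refl)
  incident-old (inj₂ (_ , _ , _ , gy)) (inj₂ refl) = inj₂ (sym gy , refl)

  Covers-new⇒∈end₁ : ∀ {g x L} → Covers L (inj₂ (g , x)) → inj₂ (g , x) ∈ map end₁ (addedAt g L)
  Covers-new⇒∈end₁ {g} {L = L} x∈L with e , e∈L , x∈e ← find x∈L with e∈g , end₁≡x ← incident-new e x∈e =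
    subst (_∈ map end₁ (addedAt g L)) end₁≡x (∈-map⁺ end₁ (∈-filter⁺ (addedAt? g) e∈L e∈g))

  end₁∈newVertices : ∀ {g} e → AddedAt g e → end₁ e ∈ newVertices g
  end₁∈newVertices (inj₂ (_ , x , _)) refl = ∈-map⁺ _ (∈-allFin x)

  end₂∈oldVertices : ∀ {g} e → AddedAt g e → end₂ e ∈ oldVertices g
  end₂∈oldVertices (inj₂ (_ , _ , _ , gy≡g)) refl = ∈-oldVertices⁺ gy≡g

  ∈-addedAt-end₂ : ∀ {g L u} → u ∈ map end₂ (addedAt g L) → ∃ λ f → f ∈ L × AddedAt g f × Incident H u f
  ∈-addedAt-end₂ {g} {L} u∈ with f , f∈ , refl ← ∈-map⁻ end₂ u∈
                            with f∈L , f∈g ← ∈-filter⁻ (addedAt? g) {xs = L} f∈ = f , f∈L , f∈g , inj₂ refl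

  length-addedAt≤ : ∀ g {L} → IsMatching H L → length (addedAt g L) ℕ.≤ size g ∸ ρ g
  length-addedAt≤ g {L} L-matching = begin
    length (addedAt g L)          ≡⟨ length-map end₁ (addedAt g L) ⟨
    length (map end₁ (addedAt g L)) ≤⟨ unique∧⊆⇒length≤ (proj₁ (addedAt-ends-unique g L-matching)) end₁⊆ ⟩
    length (newVertices g)        ≡⟨ length-newVertices g ⟩
    size g ∸ ρ g                  ∎
    where
      open ℕ.≤-Reasoning
      end₁⊆ : map end₁ (addedAt g L) ⊆ newVertices g
      end₁⊆ v∈ with e , e∈ , refl ← ∈-map⁻ end₁ v∈ =
        end₁∈newVertices e (proj₂ (∈-filter⁻ (addedAt? g) {xs = L} e∈))

  uncoveredNewVertex : ∀ g {L} → length (addedAt g L) ℕ.< size g ∸ ρ g → ∃ λ x → ¬ Covers L (inj₂ (g , x))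
  uncoveredNewVertex g {L} short =
    let x , x∉ = Any.satisfied (Any.map⁻ (unique∧shorter⇒∃∉ _≟ᴴ_ (newVertices-unique g) shorter))
    in x , x∉ ∘ Covers-new⇒∈end₁
    where
      shorter : length (map end₁ (addedAt g L)) ℕ.< length (newVertices g)
      shorter = subst₂ ℕ._<_ (sym (length-map end₁ (addedAt g L))) (sym (length-newVertices g)) short

  addNewEdge : ∀ {g x y L} (gy≡g : grp y ≡ g) → ¬ Covers L (inj₂ (g , x)) → ¬ Covers L (inj₁ y) →
               IsMatching H L → IsMatching H (inj₂ (g , x , y , gy≡g) ∷ L)
  addNewEdge {g} {x} {y} {L} gy≡g ¬x∈L ¬y∈L L-matching = All.tabulate edge# ∷ L-matching
    where
      edge# : ∀ {f} → f ∈ L → Disjointₑ H (inj₂ (g , x , y , gy≡g)) f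
      edge# f∈L _ (inj₁ refl) x∈f = ¬x∈L (lose f∈L x∈f)
      edge# f∈L _ (inj₂ refl) y∈f = ¬y∈L (lose f∈L y∈f)

  -- Extending a feasible matching

  record Extension (N : List (Fin m)) : Set where
    field
      edges      : List EH
      isMatching : IsMatching H edges
      keepsN     : ∀ {e} → e ∈ N → inj₁ e ∈ edges
      weight-pᴴ  : weight pᴴ edges ≡ weight p N
  open Extension

  module _ {N g} (X : Extension N) {S : List (Fin n)}
           (S-sound : All (λ y → grp y ≡ g × Any (λ e → ⊤ × Incident G y e) N) S) where

    groupCover : List VH
    groupCover = map inj₁ S ++ map end₂ (addedAt g (edges X))

    S-edge : ∀ {u} → u ∈ map inj₁ S → ∃ λ e → inj₁ e ∈ edges X × Incident H u (inj₁ e)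
    S-edge u∈ with y , y∈S , refl ← ∈-map⁻ inj₁ u∈
              with e , e∈N , _ , y∈e ← find (proj₂ (All.lookup S-sound y∈S)) = e , keepsN X e∈N , incident-E⁺ y∈e

    groupCover-covered : ∀ {u} → u ∈ groupCover → Covers (edges X) u
    groupCover-covered u∈ with ∈-++⁻ (map inj₁ S) u∈
    ... | inj₁ u∈S = let _ , e∈L , u∈e = S-edge u∈S in lose e∈L u∈e
    ... | inj₂ u∈A = let _ , f∈L , _ , u∈f = ∈-addedAt-end₂ u∈A in lose f∈L u∈f

    groupCover-unique : Unique S → Unique groupCover
    groupCover-unique S-unique =
      Unique.++⁺ (Unique.map⁺ Sum.inj₁-injective S-unique) (proj₂ (addedAt-ends-unique g (isMatching X))) S#A
      where
        S#A : ∀ {u} → ¬ (u ∈ map inj₁ S × u ∈ map end₂ (addedAt g (edges X)))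
        S#A (u∈S , u∈A) with e , e∈L , u∈e ← S-edge u∈S with f , f∈L , f∈g , u∈f ← ∈-addedAt-end₂ u∈A =
          subst (AddedAt g) (sym (IsMatching⇒incident-unique H (isMatching X) e∈L f∈L u∈e u∈f)) f∈g

    groupCover⊆oldVertices : groupCover ⊆ oldVertices g
    groupCover⊆oldVertices u∈ with ∈-++⁻ (map inj₁ S) u∈
    ... | inj₁ u∈S with y , y∈S , refl ← ∈-map⁻ inj₁ u∈S = ∈-oldVertices⁺ (proj₁ (All.lookup S-sound y∈S))
    ... | inj₂ u∈A with f , f∈ , refl ← ∈-map⁻ end₂ u∈A =
      end₂∈oldVertices f (proj₂ (∈-filter⁻ (addedAt? g) {xs = edges X} f∈))

    length-groupCover : length groupCover ≡ length S ℕ.+ length (addedAt g (edges X))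
    length-groupCover = trans (length-++ (map inj₁ S))
      (cong₂ ℕ._+_ (length-map inj₁ S) (length-map end₂ (addedAt g (edges X))))

  -- v, the witnesses of feasibility in V_g and the V_g-ends of the added edges at g
  -- are distinct vertices of V_g.
  uncovered⇒addedAt-short : ∀ {N v} (X : Extension N) →
    AtLeastCovered G (ρ (grp v)) (λ y → grp y ≡ grp v) (λ _ → ⊤) N → ¬ Covers (edges X) (inj₁ v) →
    length (addedAt (grp v) (edges X)) ℕ.< size (grp v) ∸ ρ (grp v)
  uncovered⇒addedAt-short {v = v} X (S , S-unique , ρ≤|S| , S-sound) ¬v∈X = +<⇒<∸ ρ≤|S| (begin-strict
    length S ℕ.+ length (addedAt g (edges X)) ≡⟨ length-groupCover X S-sound ⟨
    length (groupCover X S-sound)              <⟨ unique∧⊆⇒length≤ v∷cover-unique v∷cover⊆oldVertices ⟩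
    length (oldVertices g)                     ≡⟨ length-oldVertices g ⟩
    size g                                     ∎)
    where
      open ℕ.≤-Reasoning
      g = grp v
      v∷cover-unique : Unique (inj₁ v ∷ groupCover X S-sound)
      v∷cover-unique =
        All.tabulate (λ u∈ v≡u → ¬v∈X (subst (Covers (edges X)) (sym v≡u) (groupCover-covered X S-sound u∈)))
        ∷ groupCover-unique X S-sound S-unique
      v∷cover⊆oldVertices : inj₁ v ∷ groupCover X S-sound ⊆ oldVertices g
      v∷cover⊆oldVertices (here refl) = ∈-oldVertices⁺ refl
      v∷cover⊆oldVertices (there u∈)  = groupCover⊆oldVertices X S-sound u∈

  module _ {N : List (Fin m)} (N-covers : ∀ g → AtLeastCovered G (ρ g) (λ v → grp v ≡ g) (λ _ → ⊤) N) where

    extendToCover : ∀ v (X : Extension N) →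
                    Σ (Extension N) λ X′ → edges X ⊆ edges X′ × Covers (edges X′) (inj₁ v)
    extendToCover v X with covers? (edges X) (inj₁ v)
    ... | yes v∈X = X , id , v∈X
    ... | no ¬v∈X
      with x , ¬x∈X ← uncoveredNewVertex (grp v) (uncovered⇒addedAt-short X (N-covers (grp v)) ¬v∈X) =
      X′ , there , here (inj₂ refl)
      where
        X′ : Extension N
        X′ = record
          { edges      = inj₂ (grp v , x , v , refl) ∷ edges X
          ; isMatching = addNewEdge refl ¬x∈X ¬v∈X (isMatching X)
          ; keepsN     = there ∘ keepsN X
          ; weight-pᴴ  = trans (ℚ.+-identityˡ _) (weight-pᴴ X)
          }

    extendToCoverAll : ∀ vs (X : Extension N) →
                       Σ (Extension N) λ X′ → edges X ⊆ edges X′ × All (Covers (edges X′) ∘ inj₁) vs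
    extendToCoverAll []       X = X , id , []
    extendToCoverAll (v ∷ vs) X =
      let X₁ , X⊆X₁ , v∈X₁  = extendToCover v X
          X₂ , X₁⊆X₂ , vs∈X₂ = extendToCoverAll vs X₁
      in X₂ , X₁⊆X₂ ∘ X⊆X₁ , Any-resp-⊆ X₁⊆X₂ v∈X₁ ∷ vs∈X₂

  trivialExtension : ∀ {N} → IsMatching G N → Extension N
  trivialExtension {N} N-matching = record
    { edges      = map inj₁ N
    ; isMatching = AllPairs.map⁺ (AllPairs.map disjoint-E⁺ N-matching)
    ; keepsN     = ∈-map⁺ inj₁
    ; weight-pᴴ  = weight-map pᴴ inj₁ N
    }

  -- Maximum-weight matchings of H

  totalP≥0 : 0ℚ ≤ totalP
  totalP≥0 = subst (0ℚ ≤_) (weight-tabulate m p id) (weight-nonneg p p≥0 (allFin m))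

  weight-p≤totalP : ∀ {N} → IsMatching G N → weight p N ≤ totalP
  weight-p≤totalP {N} N-matching = subst (weight p N ≤_) (weight-tabulate m p id)
    (unique∧⊆⇒weight≤ p p≥0 (IsMatching⇒Unique G N-matching) (λ _ → ∈-allFin _))

  feasible⇒coveringMatching : Feasible →
    ∃ λ L → IsMatching H L × weight pᴴ L ≤ totalP × (∀ v → Covers L (inj₁ v))
  feasible⇒coveringMatching (N , N-matching , N-covers) =
    let X , _ , allCovered = extendToCoverAll N-covers (allFin n) (trivialExtension N-matching)
    in edges X , isMatching X , subst (_≤ totalP) (sym (weight-pᴴ X)) (weight-p≤totalP N-matching) ,
       λ v → All.lookup allCovered (∈-allFin v)

  uncovered⇒lighter : ∀ {M L L′ v} → 0ℚ ≤ M → weight pᴴ L < M → (∀ u → Covers L (inj₁ u)) →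
                      IsMatching H L′ → ¬ Covers L′ (inj₁ v) → ¬ (weight (wH M) L ≤ weight (wH M) L′)
  uncovered⇒lighter {M} {L} {L′} {v} M≥0 P<M L-covers L′-matching ¬v∈L′ W≤W′ = ℚ.<-irrefl refl (begin-strict
    W′ + M                            ≡⟨ cong (_+ M) (ℚ.+-identityʳ W′) ⟨
    (W′ + 0ℚ) + M                     ≤⟨ ℚ.+-monoˡ-≤ M (ℚ.+-monoʳ-≤ W′ (weight-nonneg pᴴ pᴴ≥0 L′)) ⟩
    (W′ + weight pᴴ L′) + M           ≡⟨ cong (_+ M) (weight-wH M L′) ⟩
    weight c (coveredOld L′) + M      ≡⟨ ℚ.+-comm _ M ⟩
    weight c (v ∷ coveredOld L′)      ≤⟨ unique∧⊆⇒weight≤ c (λ _ → M≥0) v∷L′-unique v∷L′⊆L ⟩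
    weight c (coveredOld L)           ≡⟨ weight-wH M L ⟨
    weight (wH M) L + weight pᴴ L     ≤⟨ ℚ.+-monoˡ-≤ (weight pᴴ L) W≤W′ ⟩
    W′ + weight pᴴ L                  <⟨ ℚ.+-monoʳ-< W′ P<M ⟩
    W′ + M                            ∎)
    where
      open ℚ.≤-Reasoning
      W′ = weight (wH M) L′
      c = λ (_ : Fin n) → M
      v∷L′-unique : Unique (v ∷ coveredOld L′)
      v∷L′-unique = All.tabulate (λ u∈ v≡u → ¬v∈L′ (∈coveredOld⇒Covers (subst (_∈ _) (sym v≡u) u∈)))
                  ∷ coveredOld-unique L′-matching
      v∷L′⊆L : v ∷ coveredOld L′ ⊆ coveredOld L
      v∷L′⊆L _ = Covers⇒∈coveredOld (L-covers _)

  maximum⇒covering : ∀ {M MH} → totalP < M → Feasible → IsMatching H MH →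
                     (∀ L → IsMatching H L → weight (wH M) L ≤ weight (wH M) MH) →
                     ∀ v → Covers MH (inj₁ v)
  maximum⇒covering {M} {MH} totalP<M feasible MH-matching MH-maximum v with covers? MH (inj₁ v)
  ... | yes v∈MH = v∈MH
  ... | no ¬v∈MH =
    let L , L-matching , pᴴL≤totalP , L-covers = feasible⇒coveringMatching feasible
        M≥0 = ℚ.<⇒≤ (ℚ.≤-<-trans totalP≥0 totalP<M)
    in ⊥-elim (uncovered⇒lighter M≥0 (ℚ.≤-<-trans pᴴL≤totalP totalP<M) L-covers MH-matching ¬v∈MH
                                 (MH-maximum L L-matching))

  covering⇒AtLeastCovered : ∀ {L} → IsMatching H L → (∀ v → Covers L (inj₁ v)) →
                            ∀ g → AtLeastCovered H (ρ g) (InGroup g) InE L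
  covering⇒AtLeastCovered {L} L-matching L-covers g = S , S-unique , ρ≤|S| , All.tabulate S-sound
    where
      coveredByE? : ∀ v → Dec (Any (λ e → InE e × Incident H v e) L)
      coveredByE? v = any? (λ e → inE? e ×-dec Incident? H _≟ᴴ_ v e) L

      S = filter coveredByE? (oldVertices g)
      S-unique = Unique.filter⁺ coveredByE? (oldVertices-unique g)

      S-sound : ∀ {u} → u ∈ S → InGroup g u × Any (λ e → InE e × Incident H u e) L
      S-sound u∈S = let u∈old , u∈E = ∈-filter⁻ coveredByE? u∈S in ∈-oldVertices⁻ u∈old , u∈E

      old⊆ : oldVertices g ⊆ S ++ map end₂ (addedAt g L)
      old⊆ u∈old with y , refl , gy≡g ← ∈-oldVertices⁻ u∈old with e , e∈L , y∈e ← find (L-covers y)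
                 with incident-old e y∈e
      ... | inj₁ e∈E = ∈-++⁺ˡ (∈-filter⁺ coveredByE? u∈old (lose e∈L (e∈E , y∈e)))
      ... | inj₂ (e∈grp-y , end₂≡y) = ∈-++⁺ʳ S (subst (_∈ map end₂ (addedAt g L)) end₂≡y
            (∈-map⁺ end₂ (∈-filter⁺ (addedAt? g) e∈L (subst (λ h → AddedAt h e) gy≡g e∈grp-y))))

      ρ≤|S| : ρ g ℕ.≤ length S
      ρ≤|S| = ≤+∸⇒≤ (ρ≤size g) (begin
        size g                                 ≡⟨ length-oldVertices g ⟨
        length (oldVertices g)                 ≤⟨ unique∧⊆⇒length≤ (oldVertices-unique g) old⊆ ⟩
        length (S ++ map end₂ (addedAt g L))   ≡⟨ length-++ S ⟩
        length S ℕ.+ length (map end₂ (addedAt g L)) ≡⟨ cong (length S ℕ.+_) (length-map end₂ (addedAt g L)) ⟩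
        length S ℕ.+ length (addedAt g L)      ≤⟨ ℕ.+-monoʳ-≤ (length S) (length-addedAt≤ g L-matching) ⟩
        length S ℕ.+ (size g ∸ ρ g)            ∎)
        where open ℕ.≤-Reasoning

lemma12 : (I : WBM) → let open WBM I in
          (M : ℚ) → totalP < M → Feasible →
          (MH : List EH) → IsMatching H MH →
          (∀ N → IsMatching H N → weight (wH M) N ≤ weight (wH M) MH) →
          ∀ g → AtLeastCovered H (ρ g) (λ v → Σ (Fin n) (λ y → v ≡ inj₁ y × grp y ≡ g)) InE MH
lemma12 I M totalP<M feasible MH MH-matching MH-maximum =
  covering⇒AtLeastCovered I MH-matching (maximum⇒covering I totalP<M feasible MH-matching MH-maximum)
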